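{- For every positive integer $n$, during a complete run of $\mathrm{RuleDesc}(n)$, the read statements "$m\leftarrow d_k$" (both occurrences together) are executed a total of exactly $\sum_{x=1}^{n}p(x) - n$ times.
   Context: $p(n)$ denotes the number of partitions of $n$. The procedure $\mathrm{RuleDesc}(n)$, for $n>0$, operates on an array $d$ as follows and visits every descending composition of $n$ (a sequence of positive integers in nonincreasing order summing to $n$) exactly once, in reverse lexicographic order: 1. $d_1\leftarrow n$; $k\leftarrow 1$; visit $\langle d_1\rangle$. 2. While $k\ne n$: - $\ell\leftarrow k$; $m\leftarrow d_k$. - While $m=1$: $k\leftarrow k-1$; $m\leftarrow d_k$. - $n'\leftarrow m+\ell-k$; $m\leftarrow m-1$. - While $m<n'$: $d_k\leftarrow m$; $n'\leftarrow n'-m$; $k\leftarrow k+1$. - $d_k\leftarrow n'$; visit $\langle d_1,\dots,d_k\rangle$. -}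

module Defs where

open import Data.Nat using (ℕ; zero; suc; _+_; _∸_; _≤_; _≥_; _≡ᵇ_; _<ᵇ_)
open import Data.Bool using (if_then_else_)
open import Data.List using (List)
open import Data.Nat.ListAction using (sum)
open import Data.List.Relation.Unary.All using (All)
open import Data.List.Relation.Unary.Linked using (Linked)
open import Data.Maybe using (Maybe; just; nothing; _>>=_)
open import Data.Product using (_×_; _,_; Σ)
open import Relation.Binary.PropositionalEquality using (_≡_)

Partition : ℕ → Set
Partition x = Σ (List ℕ) λ l → Linked _≥_ l × All (λ a → 1 ≤ a) l × sum l ≡ x

sumFrom1 : (ℕ → ℕ) → ℕ → ℕ
sumFrom1 P zero    = 0
sumFrom1 P (suc n) = sumFrom1 P n + P (suc n)

-- The array d, indexed by ℕ (positions 1,2,...).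

Array : Set
Array = ℕ → ℕ

_[_≔_] : Array → ℕ → ℕ → Array
(d [ i ≔ v ]) j = if j ≡ᵇ i then v else d j

-- Interpreter for RuleDesc(n), counting executions of the read
-- statement "m ← d_k" (both occurrences).  A single fuel parameter
-- bounds every loop iteration; 'nothing' means fuel ran out.

-- "While m = 1: k ← k-1; m ← d_k."   returns (k , m , reads)
loop1 : ℕ → Array → ℕ → ℕ → ℕ → Maybe (ℕ × ℕ × ℕ)
loop1 zero    d k m c = nothing
loop1 (suc f) d k m c =
  if m ≡ᵇ 1 then loop1 f d (k ∸ 1) (d (k ∸ 1)) (suc c) else just (k , m , c)

-- "While m < n': d_k ← m; n' ← n' - m; k ← k+1."  returns (d , k , n')
loop2 : ℕ → Array → ℕ → ℕ → ℕ → Maybe (Array × ℕ × ℕ)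
loop2 zero    d k m n' = nothing
loop2 (suc f) d k m n' =
  if m <ᵇ n' then loop2 f (d [ k ≔ m ]) (suc k) m (n' ∸ m) else just (d , k , n')

-- Outer loop "While k ≠ n: ..."; returns the total number of reads.
outer : ℕ → ℕ → Array → ℕ → ℕ → Maybe ℕ
outer zero    n d k c = nothing
outer (suc f) n d k c =
  if k ≡ᵇ n then just c else
    (loop1 f d k (d k) (suc c) >>= λ where
      (k' , m , c') → loop2 f d k' (m ∸ 1) (m + k ∸ k') >>= λ where
        (d' , k'' , n') → outer f n (d' [ k'' ≔ n' ]) k'' c')

-- Step 1: d_1 ← n; k ← 1 (other entries of d are irrelevant, set to 0).
ruleDescReads : (fuel n : ℕ) → Maybe ℕ
ruleDescReads f n = outer f n ((λ _ → 0) [ 1 ≔ n ]) 1 0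

module Submission where

-- RuleDesc(n) reads d_k once per outer iteration plus once for every
-- trailing 1 it skips.  Call a block at
-- positions j+1, … a head a followed by the greedy composition of R into
-- parts a (exactly what the second inner loop writes).  By induction on the
-- total T = a + R and then on a, the run turns such a block into T ones,
-- leaving everything before it untouched, after
--     Σ_{i=0}^{T} nBPart a i − T − 1
-- reads, where nBPart a i counts partitions of i into parts ≤ a.  For a ≥ 2
-- the tail is first turned into ones, one outer iteration then replaces the
-- head a by the greedy composition of a + R into parts a − 1, and the costs
-- add up by the recurrence nBPart (a) x = nBPart (a−1) x + nBPart a (x − a).
-- For the initial block ⟨n⟩ this gives Σ_{i=0}^{n} p(i) − n − 1 reads,
-- i.e. Σ_{x=1}^{n} p(x) − n, once nBPart x x is identified with p(x)
-- through an explicit bijection between partitions and BPart x x.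

open import Defs
open import Data.Bool using (true; false; if_then_else_)
import Data.Bool as Bool
open import Data.Bool.Properties using (T-≡)
open import Data.Empty using (⊥; ⊥-elim)
open import Data.Fin using (Fin)
open import Data.Fin.Properties using (cantor-schröder-bernstein; +↔⊎)
open import Data.List using (List; []; _∷_; length; replicate)
open import Data.List.Properties using (length-replicate; ∷-injectiveʳ)
open import Data.List.Relation.Unary.All as All using (All; []; _∷_)
open import Data.List.Relation.Unary.AllPairs using (_∷_)
open import Data.List.Relation.Unary.Linked as Linked using (Linked; []; [-]; _∷_)
open import Data.List.Relation.Unary.Linked.Properties using (Linked⇒AllPairs)
open import Data.Maybe using (just)
open import Data.Nat
open import Data.Nat.ListAction using (sum)
open import Data.Nat.Properties
open import Algebra.Properties.CommutativeSemigroup +-commutativeSemigroup using (interchange)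
open import Data.Nat.Tactic.RingSolver using (solve-∀)
open import Data.Product using (Σ; _×_; _,_; ∃-syntax)
open import Data.Sum using (_⊎_; inj₁; inj₂)
open import Data.Sum.Function.Propositional using (_⊎-↔_)
open import Data.Unit using (⊤; tt)
open import Function.Bundles using (Equivalence; Injection; _↔_; mk↔ₛ′)
open import Function.Properties.Inverse using (↔-sym; ↔-trans; ↔⇒↣)
open import Relation.Binary.PropositionalEquality
open import Relation.Nullary using (Dec; yes; no)

<ᵇ-true : ∀ {m n} → m < n → (m <ᵇ n) ≡ true
<ᵇ-true m<n = Equivalence.to T-≡ (<⇒<ᵇ m<n)

<ᵇ-false : ∀ {m n} → n ≤ m → (m <ᵇ n) ≡ false
<ᵇ-false {m} {n} n≤m with m <ᵇ n in eq
... | true  = ⊥-elim (≤⇒≯ n≤m (<ᵇ⇒< m n (Equivalence.from T-≡ eq)))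
... | false = refl

Fin-cast : ∀ {A : Set} {a b} → a ≡ b → A ↔ Fin a → A ↔ Fin b
Fin-cast refl A↔a = A↔a

Fin-injective : ∀ {a b} → Fin a ↔ Fin b → a ≡ b
Fin-injective a↔b = cantor-schröder-bernstein
  (Injection.injective (↔⇒↣ a↔b)) (Injection.injective (↔⇒↣ (↔-sym a↔b)))

-- Partitions with bounded parts and their number

-- BPart m x: partitions of x into parts ≤ m, built by deciding, for the
-- largest admissible part size, whether to use it once more (take) or to
-- forbid it from now on (skip).
data BPart : ℕ → ℕ → Set where
  nil  : BPart 0 0
  skip : ∀ {m x} → BPart m x → BPart (suc m) x
  take : ∀ {m x} → BPart (suc m) x → BPart (suc m) (suc m + x)

-- multiplicitySum q m f y = q y + q (y ∸ (m+1)) + q (y ∸ 2(m+1)) + ⋯,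
-- summed over all multiplicities of the part m+1 that fit into y;
-- f is fuel, and f ≥ y is enough (multiplicitySum-fuel).
multiplicitySum : (ℕ → ℕ) → ℕ → ℕ → ℕ → ℕ
multiplicitySum q m zero    y = q y
multiplicitySum q m (suc f) y =
  q y + (if m <ᵇ y then multiplicitySum q m f (y ∸ suc m) else 0)

-- nBPart m x = number of partitions of x into parts ≤ m: classify the
-- partitions with parts ≤ m+1 by the multiplicity of the part m+1.
nBPart : ℕ → ℕ → ℕ
nBPart zero    zero    = 1
nBPart zero    (suc x) = 0
nBPart (suc m) x       = multiplicitySum (nBPart m) m x x

∸-fuel : ∀ y f m → y ≤ suc f → y ∸ suc m ≤ f
∸-fuel zero    f m _         = z≤n
∸-fuel (suc y) f m (s≤s y≤f) = ≤-trans (m∸n≤m y m) y≤f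

multiplicitySum-fuel : ∀ q m {f f'} y → y ≤ f → y ≤ f' →
  multiplicitySum q m f y ≡ multiplicitySum q m f' y
multiplicitySum-fuel q m {zero}  {zero}   y   _   _ = refl
multiplicitySum-fuel q m {zero}  {suc f'} .0 z≤n _  = sym (+-identityʳ (q 0))
multiplicitySum-fuel q m {suc f} {zero}   .0 z≤n _  = +-identityʳ (q 0)
multiplicitySum-fuel q m {suc f} {suc f'} y  y≤f y≤f' with m <ᵇ y
... | true  = cong (q y +_)
  (multiplicitySum-fuel q m (y ∸ suc m) (∸-fuel y f m y≤f) (∸-fuel y f' m y≤f'))
... | false = refl

nTake : ℕ → ℕ → ℕ
nTake m x = if m <ᵇ x then nBPart (suc m) (x ∸ suc m) else 0

-- The recurrence: a partition into parts ≤ m+1 either avoids m+1 or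
-- uses it.
nBPart-rec : ∀ m x → nBPart (suc m) x ≡ nBPart m x + nTake m x
nBPart-rec m zero    = sym (+-identityʳ _)
nBPart-rec m (suc x) with m <ᵇ suc x
... | true  = cong (nBPart m (suc x) +_)
  (multiplicitySum-fuel (nBPart m) m (suc x ∸ suc m) (∸-fuel (suc x) x m ≤-refl) ≤-refl)
... | false = refl

nTake-small : ∀ m x → x ≤ m → nTake m x ≡ 0
nTake-small m x x≤m = cong (λ b → if b then nBPart (suc m) (x ∸ suc m) else 0) (<ᵇ-false x≤m)

nTake-large : ∀ m z → nTake m (suc m + z) ≡ nBPart (suc m) z
nTake-large m z = begin
  nTake m x                   ≡⟨ cong (λ b → if b then nBPart (suc m) (x ∸ suc m) else 0) m<x ⟩
  nBPart (suc m) (x ∸ suc m)  ≡⟨ cong (nBPart (suc m)) (m+n∸m≡n (suc m) z) ⟩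
  nBPart (suc m) z            ∎
  where open ≡-Reasoning
        x = suc m + z
        m<x = <ᵇ-true {m} {x} (s≤s (m≤m+n m z))

-- Sums x ≤ m cannot use the part m+1.
nBPart-small : ∀ m x → x ≤ m → nBPart (suc m) x ≡ nBPart m x
nBPart-small m x x≤m =
  trans (nBPart-rec m x) (trans (cong (nBPart m x +_) (nTake-small m x x≤m)) (+-identityʳ _))

nBPart-zero : ∀ m → nBPart m 0 ≡ 1
nBPart-zero zero    = refl
nBPart-zero (suc m) = nBPart-zero m

nBPart-one : ∀ x → nBPart 1 x ≡ 1
nBPart-one zero    = refl
nBPart-one (suc x) = trans (nBPart-rec 0 (suc x)) (nBPart-one x)

-- Partitions that use the part m+1, with that part removed.
Takes : ℕ → ℕ → Set
Takes m x = Σ ℕ λ y → suc m + y ≡ x × BPart (suc m) y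

BPart-split : ∀ m x → BPart (suc m) x ↔ (BPart m x ⊎ Takes m x)
BPart-split m x = mk↔ₛ′ to from to-from from-to
  where
  to : ∀ {x} → BPart (suc m) x → BPart m x ⊎ Takes m x
  to (skip d) = inj₁ d
  to (take d) = inj₂ (_ , refl , d)
  from : ∀ {x} → BPart m x ⊎ Takes m x → BPart (suc m) x
  from (inj₁ d)              = skip d
  from (inj₂ (y , refl , d)) = take d
  to-from : ∀ {x} (t : BPart m x ⊎ Takes m x) → to (from t) ≡ t
  to-from (inj₁ d)              = refl
  to-from (inj₂ (y , refl , d)) = refl
  from-to : ∀ {x} (d : BPart (suc m) x) → from (to d) ≡ d
  from-to (skip d) = refl
  from-to (take d) = refl

Takes-small : ∀ m x → x ≤ m → Takes m x ↔ Fin 0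
Takes-small m x x≤m = mk↔ₛ′ (λ t → ⊥-elim (absurd t)) (λ ()) (λ ()) (λ t → ⊥-elim (absurd t))
  where
  absurd : Takes m x → ⊥
  absurd (y , refl , _) = <⇒≱ (s≤s (m≤m+n m y)) x≤m

Takes-large : ∀ m z → Takes m (suc m + z) ↔ BPart (suc m) z
Takes-large m z = mk↔ₛ′ to (λ d → z , refl , d) to-from from-to
  where
  to : Takes m (suc m + z) → BPart (suc m) z
  to (y , e , d) = subst (BPart (suc m)) (+-cancelˡ-≡ (suc m) y z e) d
  to-from : ∀ d → to (z , refl , d) ≡ d
  to-from d = cong (λ e → subst (BPart (suc m)) e d) (≡-irrelevant (+-cancelˡ-≡ (suc m) z z refl) refl)
  pair-eq : ∀ {y} (y≡z : y ≡ z) (e : suc m + y ≡ suc m + z) d →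
    _≡_ {A = Takes m (suc m + z)} (z , refl , subst (BPart (suc m)) y≡z d) (y , e , d)
  pair-eq refl e d = cong (λ e' → (z , e' , d)) (≡-irrelevant refl e)
  from-to : ∀ t → (z , refl , to t) ≡ t
  from-to (y , e , d) = pair-eq (+-cancelˡ-≡ (suc m) y z e) e d

small-or-large : ∀ m x → x ≤ m ⊎ Σ ℕ λ z → x ≡ suc m + z
small-or-large m x with x ≤? m
... | yes x≤m = inj₁ x≤m
... | no  x≰m = inj₂ (x ∸ suc m , sym (m+[n∸m]≡n (≰⇒> x≰m)))

Takes-card : ∀ m x → (∀ z → z < x → BPart (suc m) z ↔ Fin (nBPart (suc m) z)) →
  Takes m x ↔ Fin (nTake m x)
Takes-card m x ih with small-or-large m x
... | inj₁ x≤m        = Fin-cast (sym (nTake-small m x x≤m)) (Takes-small m x x≤m)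
... | inj₂ (z , refl) = Fin-cast (sym (nTake-large m z))
  (↔-trans (Takes-large m z) (ih z (s≤s (m≤n+m z m))))

BPart-card : ∀ bound m x → x ≤ bound → BPart m x ↔ Fin (nBPart m x)
BPart-card bound zero x _ = base x
  where
  base : ∀ x → BPart zero x ↔ Fin (nBPart zero x)
  base zero    = mk↔ₛ′ (λ _ → Fin.zero) (λ _ → nil)
    (λ { Fin.zero → refl ; (Fin.suc ()) }) (λ { nil → refl })
  base (suc x) = mk↔ₛ′ (λ ()) (λ ()) (λ ()) (λ ())
BPart-card bound (suc m) x x≤bound = Fin-cast (sym (nBPart-rec m x))
  (↔-trans (BPart-split m x)
  (↔-trans (BPart-card bound m x x≤bound ⊎-↔ Takes-card m x (smaller bound x≤bound))
  (↔-sym +↔⊎)))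
  where
  smaller : ∀ bound → x ≤ bound → ∀ z → z < x → BPart (suc m) z ↔ Fin (nBPart (suc m) z)
  smaller zero      x≤0 z z<x = ⊥-elim (<⇒≱ (≤-trans z<x x≤0) z≤n)
  smaller (suc bnd) x≤b z z<x = BPart-card bnd (suc m) z (≤-pred (≤-trans z<x x≤b))

-- Partitions of x are the partitions of x into parts ≤ x

parts : ∀ {m x} → BPart m x → List ℕ
parts nil      = []
parts (skip d) = parts d
parts (take {m} d) = suc m ∷ parts d

parts-bounded : ∀ {m x} (d : BPart m x) → All (_≤ m) (parts d)
parts-bounded nil      = []
parts-bounded (skip d) = All.map (λ a≤m → m≤n⇒m≤1+n a≤m) (parts-bounded d)
parts-bounded (take d) = ≤-refl ∷ parts-bounded d

parts-positive : ∀ {m x} (d : BPart m x) → All (1 ≤_) (parts d)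
parts-positive nil      = []
parts-positive (skip d) = parts-positive d
parts-positive (take d) = s≤s z≤n ∷ parts-positive d

descending-cons : ∀ {a l} → All (_≤ a) l → Linked _≥_ l → Linked _≥_ (a ∷ l)
descending-cons []          _  = [-]
descending-cons (b≤a ∷ _)   lk = b≤a ∷ lk

descending-head : ∀ {a l} → Linked _≥_ (a ∷ l) → All (_≤ a) l
descending-head lk with Linked⇒AllPairs (λ b≤a c≤b → ≤-trans c≤b b≤a) lk
... | a≥l ∷ _ = a≥l

parts-descending : ∀ {m x} (d : BPart m x) → Linked _≥_ (parts d)
parts-descending nil      = []
parts-descending (skip d) = parts-descending d
parts-descending (take d) = descending-cons (parts-bounded d) (parts-descending d)

parts-sum : ∀ {m x} (d : BPart m x) → sum (parts d) ≡ x
parts-sum nil          = refl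
parts-sum (skip d)     = parts-sum d
parts-sum (take {m} d) = cong (suc m +_) (parts-sum d)

-- Rebuilding a bounded partition from a descending list of positive parts
-- ≤ m; fromPartsDec decides whether the head uses the largest size m+1.
fromParts : ∀ m l → Linked _≥_ l → All (1 ≤_) l → All (_≤ m) l → BPart m (sum l)
fromPartsDec : ∀ m h l → Linked _≥_ (h ∷ l) → All (1 ≤_) (h ∷ l) →
  All (_≤ suc m) (h ∷ l) → Dec (h ≡ suc m) → BPart (suc m) (sum (h ∷ l))
fromParts zero    []      _  _         _         = nil
fromParts zero    (h ∷ l) _  (1≤h ∷ _) (h≤0 ∷ _) = ⊥-elim (<⇒≱ 1≤h h≤0)
fromParts (suc m) []      _  _         _         = skip (fromParts m [] [] [] [])
fromParts (suc m) (h ∷ l) lk pos       bnd       = fromPartsDec m h l lk pos bnd (h ≟ suc m)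
fromPartsDec m h l lk (_ ∷ pos) _ (yes refl) =
  take (fromParts (suc m) l (Linked.tail lk) pos (descending-head lk))
fromPartsDec m h l lk (1≤h ∷ pos) (h≤1+m ∷ _) (no h≢1+m) =
  skip (fromParts m (h ∷ l) lk (1≤h ∷ pos) (h≤m ∷ All.map (λ b≤h → ≤-trans b≤h h≤m) (descending-head lk)))
  where h≤m = ≤-pred (≤∧≢⇒< h≤1+m h≢1+m)

parts-fromParts : ∀ m l lk pos bnd → parts (fromParts m l lk pos bnd) ≡ l
parts-fromPartsDec : ∀ m h l lk pos bnd dec → parts (fromPartsDec m h l lk pos bnd dec) ≡ h ∷ l
parts-fromParts zero    []      _  _         _         = refl
parts-fromParts zero    (h ∷ l) _  (1≤h ∷ _) (h≤0 ∷ _) = ⊥-elim (<⇒≱ 1≤h h≤0)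
parts-fromParts (suc m) []      _  _         _         = parts-fromParts m [] [] [] []
parts-fromParts (suc m) (h ∷ l) lk pos       bnd       = parts-fromPartsDec m h l lk pos bnd (h ≟ suc m)
parts-fromPartsDec m h l lk (_ ∷ pos) _ (yes refl) =
  cong (suc m ∷_) (parts-fromParts (suc m) l (Linked.tail lk) pos (descending-head lk))
parts-fromPartsDec m h l lk (1≤h ∷ pos) (_ ∷ _) (no _) = parts-fromParts m (h ∷ l) lk (1≤h ∷ pos) _

parts-subst : ∀ {m x y} (x≡y : x ≡ y) (d : BPart m x) → parts (subst (BPart m) x≡y d) ≡ parts d
parts-subst refl d = refl

head-unbounded : ∀ {m l} → All (_≤ m) (suc m ∷ l) → ⊥
head-unbounded (1+m≤m ∷ _) = <⇒≱ ≤-refl 1+m≤m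

parts-injective : ∀ {m x x'} (d : BPart m x) (d' : BPart m x') → parts d ≡ parts d' →
  Σ (x ≡ x') λ x≡x' → subst (BPart m) x≡x' d ≡ d'
parts-injective nil      nil       _ = refl , refl
parts-injective (skip d) (skip d') e with parts-injective d d' e
... | refl , refl = refl , refl
parts-injective (take d) (take d') e with parts-injective d d' (∷-injectiveʳ e)
... | refl , refl = refl , refl
parts-injective (skip d) (take d') e = ⊥-elim (head-unbounded (subst (All (_≤ _)) e (parts-bounded d)))
parts-injective (take d) (skip d') e = ⊥-elim (head-unbounded (subst (All (_≤ _)) (sym e) (parts-bounded d')))

parts≤sum : ∀ l → All (_≤ sum l) l
parts≤sum []      = []
parts≤sum (h ∷ l) = m≤m+n h (sum l) ∷ All.map (λ b≤s → ≤-trans b≤s (m≤n+m (sum l) h)) (parts≤sum l)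

-- Partitions with the same list of parts are equal (the side conditions are propositions).
Partition-≡ : ∀ {x l l'} → l ≡ l' →
  (p : Linked _≥_ l × All (1 ≤_) l × sum l ≡ x) (p' : Linked _≥_ l' × All (1 ≤_) l' × sum l' ≡ x) →
  _≡_ {A = Partition x} (l , p) (l' , p')
Partition-≡ refl (lk , pos , s) (lk' , pos' , s') =
  cong₂ (λ u v → (_ , u , v)) (Linked.irrelevant ≤-irrelevant lk lk')
    (cong₂ _,_ (All.irrelevant ≤-irrelevant pos pos') (≡-irrelevant s s'))

Partition↔BPart : ∀ x → Partition x ↔ BPart x x
Partition↔BPart x = mk↔ₛ′ to from to-from from-to
  where
  to : Partition x → BPart x x
  to (l , lk , pos , s) =
    subst (BPart x) s (fromParts x l lk pos (subst (λ y → All (_≤ y) l) s (parts≤sum l)))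
  from : BPart x x → Partition x
  from d = parts d , parts-descending d , parts-positive d , parts-sum d
  to-from : ∀ d → to (from d) ≡ d
  to-from d with parts-injective (to (from d)) d
                  (trans (parts-subst (parts-sum d) _) (parts-fromParts x (parts d) _ _ _))
  ... | x≡x , eq = trans (cong (λ e → subst (BPart x) e (to (from d))) (≡-irrelevant refl x≡x)) eq
  from-to : ∀ P → from (to P) ≡ P
  from-to (l , lk , pos , s) = Partition-≡ (trans (parts-subst s _) (parts-fromParts x l lk pos _)) _ _

partitionCount : (p : ℕ → ℕ) → (∀ x → Fin (p x) ↔ Partition x) → ∀ x → p x ≡ nBPart x x
partitionCount p p↔Partition x = Fin-injective
  (↔-trans (p↔Partition x) (↔-trans (Partition↔BPart x) (BPart-card x x x ≤-refl)))

-- Cumulative counts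

cumBPart : ℕ → ℕ → ℕ
cumBPart m zero    = nBPart m 0
cumBPart m (suc T) = cumBPart m T + nBPart m (suc T)

cum-small : ∀ m T → T ≤ m → cumBPart (suc m) T ≡ cumBPart m T
cum-small m zero    _     = refl
cum-small m (suc T) 1+T≤m =
  cong₂ _+_ (cum-small m T (<⇒≤ 1+T≤m)) (nBPart-small m (suc T) 1+T≤m)

cum-stable : ∀ {T a} → T ≤ a → cumBPart a T ≡ cumBPart T T
cum-stable {T} T≤a = go (≤⇒≤′ T≤a)
  where
  go : ∀ {a} → T ≤′ a → cumBPart a T ≡ cumBPart T T
  go (≤′-reflexive refl) = refl
  go (≤′-step T≤′a)      = trans (cum-small _ T (≤′⇒≤ T≤′a)) (go T≤′a)

-- Into parts ≤ 1 every sum has exactly one partition.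
cum-one : ∀ T → cumBPart 1 T ≡ suc T
cum-one zero    = refl
cum-one (suc T) = trans (cong₂ _+_ (cum-one T) (nBPart-one (suc T))) (+-comm (suc T) 1)

-- The recurrence for nBPart, summed up: this is the identity behind the
-- cost accounting of one "decrement" step of the algorithm.
cum-split : ∀ m R → cumBPart (suc m) (suc m + R) ≡ cumBPart m (suc m + R) + cumBPart (suc m) R
cum-split m R = subst (λ x → cumBPart (suc m) x ≡ cumBPart m x + cumBPart (suc m) R)
  (+-comm R (suc m)) (split R)
  where
  open ≡-Reasoning
  take-part : ∀ z → nBPart (suc m) (z + suc m) ≡ nBPart m (z + suc m) + nBPart (suc m) z
  take-part z = trans (nBPart-rec m (z + suc m))
    (cong (nBPart m (z + suc m) +_) (trans (cong (nTake m) (+-comm z (suc m))) (nTake-large m z)))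
  split : ∀ R → cumBPart (suc m) (R + suc m) ≡ cumBPart m (R + suc m) + cumBPart (suc m) R
  split zero = begin
    cumBPart (suc m) m + nBPart (suc m) (suc m)           ≡⟨ cong₂ _+_ (cum-small m m ≤-refl) (take-part 0) ⟩
    cumBPart m m + (nBPart m (suc m) + nBPart (suc m) 0)  ≡⟨ +-assoc (cumBPart m m) _ _ ⟨
    cumBPart m m + nBPart m (suc m) + nBPart (suc m) 0    ∎
  split (suc R) = begin
    cumBPart (suc m) (R + suc m) + nBPart (suc m) (suc R + suc m)
      ≡⟨ cong₂ _+_ (split R) (take-part (suc R)) ⟩
    (cumBPart m (R + suc m) + cumBPart (suc m) R) + (nBPart m (suc R + suc m) + nBPart (suc m) (suc R))
      ≡⟨ interchange (cumBPart m (R + suc m)) _ _ _ ⟩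
    (cumBPart m (R + suc m) + nBPart m (suc R + suc m)) + (cumBPart (suc m) R + nBPart (suc m) (suc R))
      ∎

cum-diagonal : ∀ T → cumBPart T T ≡ suc (sumFrom1 (λ x → nBPart x x) T)
cum-diagonal zero    = refl
cum-diagonal (suc T) = cong (_+ nBPart (suc T) (suc T)) (trans (cum-small T T ≤-refl) (cum-diagonal T))

-- The array and the two inner loops

≡ᵇ-refl : ∀ n → (n ≡ᵇ n) ≡ true
≡ᵇ-refl n = Equivalence.to T-≡ (≡⇒≡ᵇ n n refl)

≡ᵇ-< : ∀ {i j} → i < j → (i ≡ᵇ j) ≡ false
≡ᵇ-< {zero}  {suc j} _         = refl
≡ᵇ-< {suc i} {suc j} (s≤s i<j) = ≡ᵇ-< {i} {j} i<j

update-same : ∀ d i v → (d [ i ≔ v ]) i ≡ v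
update-same d i v rewrite ≡ᵇ-refl i = refl

update-other : ∀ d i j v → j < i → (d [ i ≔ v ]) j ≡ d j
update-other d i j v j<i rewrite ≡ᵇ-< j<i = refl

-- Stores d j l: the entries d_{j+1}, …, d_{j+|l|} spell out the list l.
Stores : Array → ℕ → List ℕ → Set
Stores d j []      = ⊤
Stores d j (x ∷ l) = d (suc j) ≡ x × Stores d (suc j) l

stores-replicate : ∀ d j R x → Stores d j (replicate R x) → ∀ i → i < R → d (j + suc i) ≡ x
stores-replicate d j (suc R) x (d≡x , _)  zero    _         = trans (cong d (+-comm j 1)) d≡x
stores-replicate d j (suc R) x (_ , rest) (suc i) (s≤s i<R) =
  trans (cong d (+-suc j (suc i))) (stores-replicate d (suc j) R x rest i i<R)

-- Greedy m n l: l is the greedy composition m, m, …, m, r of n with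
-- 1 ≤ r ≤ m, exactly what the second inner loop writes.
data Greedy (m : ℕ) : ℕ → List ℕ → Set where
  last : ∀ {n} → 1 ≤ n → n ≤ m → Greedy m n (n ∷ [])
  _∷_  : ∀ {n l} → m < n → Greedy m (n ∸ m) l → Greedy m n (m ∷ l)

data Greedy₀ (m : ℕ) : ℕ → List ℕ → Set where
  []     : Greedy₀ m 0 []
  greedy : ∀ {n l} → Greedy m n l → Greedy₀ m n l

greedy-ones : ∀ {R l} → Greedy 1 R l → l ≡ replicate R 1
greedy-ones (last (s≤s z≤n) (s≤s z≤n)) = refl
greedy-ones {suc R} (_ ∷ g)            = cong (1 ∷_) (greedy-ones g)

greedy₀-ones : ∀ {R l} → Greedy₀ 1 R l → l ≡ replicate R 1
greedy₀-ones []         = refl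
greedy₀-ones (greedy g) = greedy-ones g

greedy-uncons : ∀ {m n l} → Greedy m (m + suc n) l → Σ (List ℕ) λ l' → l ≡ m ∷ l' × Greedy m (suc n) l'
greedy-uncons {m} {n} (last _ m+1+n≤m)   = ⊥-elim (m+1+n≰m m m+1+n≤m)
greedy-uncons {m} {n} (_∷_ {l = l'} _ g) = l' , refl , subst (λ x → Greedy m x l') (m+n∸m≡n m (suc n)) g

loop2-continue : ∀ f d k m n' → (m <ᵇ n') ≡ true →
  loop2 (suc f) d k m n' ≡ loop2 f (d [ k ≔ m ]) (suc k) m (n' ∸ m)
loop2-continue f d k m n' m<n' rewrite m<n' = refl

loop2-stop : ∀ f d k m n' → (m <ᵇ n') ≡ false → loop2 (suc f) d k m n' ≡ just (d , k , n')
loop2-stop f d k m n' m≮n' rewrite m≮n' = refl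

loop2-fuel : ∀ {f f' d k m n' r} → f ≤ f' → loop2 f d k m n' ≡ just r → loop2 f' d k m n' ≡ just r
loop2-fuel {zero} _ ()
loop2-fuel {suc f} {suc f'} {d} {k} {m} {n'} (s≤s f≤f') done with m <ᵇ n'
... | true  = loop2-fuel f≤f' done
... | false = done

outer-step : ∀ {f n d k c k' m c' d' k'' n''} → (k ≡ᵇ n) ≡ false →
  loop1 f d k (d k) (suc c) ≡ just (k' , m , c') →
  loop2 f d k' (m ∸ 1) (m + k ∸ k') ≡ just (d' , k'' , n'') →
  outer (suc f) n d k c ≡ outer f n (d' [ k'' ≔ n'' ]) k'' c'
outer-step k≢n loop1≡ loop2≡ rewrite k≢n | loop1≡ | loop2≡ = refl

outer-end : ∀ f n d c → outer (suc f) n d n c ≡ just c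
outer-end f n d c rewrite ≡ᵇ-refl n = refl

-- The outcome of the second inner loop started at position j+1: it writes
-- the greedy composition of n' into parts m (the last entry is written by
-- the outer loop), leaving d_1, …, d_j untouched.
record Fill (f j : ℕ) (d : Array) (m n' : ℕ) : Set where
  field
    d₂       : Array
    k₂       : ℕ
    r₂       : ℕ
    written  : List ℕ
    loop2≡   : loop2 f d (suc j) m n' ≡ just (d₂ , k₂ , r₂)
    isGreedy : Greedy m n' written
    stores   : Stores (d₂ [ k₂ ≔ r₂ ]) j written
    k₂≡      : k₂ ≡ j + length written
    prefix   : ∀ i → i ≤ j → (d₂ [ k₂ ≔ r₂ ]) i ≡ d i

fill : ∀ f j d m n' → 1 ≤ m → 1 ≤ n' → n' ≤ f → Fill f j d m n'
fill zero    j d m       n' _         1≤n' n'≤0 = ⊥-elim (<⇒≱ 1≤n' n'≤0)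
fill (suc f) j d (suc m) n' (s≤s z≤n) 1≤n' n'≤f with suc m <ᵇ n' in eq
... | true = record
  { d₂       = R.d₂ ; k₂ = R.k₂ ; r₂ = R.r₂
  ; written  = suc m ∷ R.written
  ; loop2≡   = trans (loop2-continue f d (suc j) (suc m) n' eq) R.loop2≡
  ; isGreedy = m<n' ∷ R.isGreedy
  ; stores   = trans (R.prefix (suc j) ≤-refl) (update-same d (suc j) (suc m)) , R.stores
  ; k₂≡      = trans R.k₂≡ (sym (+-suc j _))
  ; prefix   = λ i i≤j → trans (R.prefix i (m≤n⇒m≤1+n i≤j)) (update-other d (suc j) i (suc m) (s≤s i≤j))
  }
  where
  m<n' : suc m < n'
  m<n' = <ᵇ⇒< (suc m) n' (Equivalence.from T-≡ eq)
  rest : Fill f (suc j) (d [ suc j ≔ suc m ]) (suc m) (n' ∸ suc m)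
  rest = fill f (suc j) (d [ suc j ≔ suc m ]) (suc m) (n' ∸ suc m)
    (s≤s z≤n) (m<n⇒0<n∸m m<n') (∸-fuel n' f m n'≤f)
  module R = Fill rest
... | false = record
  { d₂       = d ; k₂ = suc j ; r₂ = n'
  ; written  = n' ∷ []
  ; loop2≡   = loop2-stop f d (suc j) (suc m) n' eq
  ; isGreedy = last 1≤n' (≮⇒≥ (λ m<n' → subst Bool.T eq (<⇒<ᵇ m<n')))
  ; stores   = update-same d (suc j) n' , tt
  ; k₂≡      = sym (+-comm j 1)
  ; prefix   = λ i i≤j → update-other d (suc j) i n' (s≤s i≤j)
  }

loop1-ones : ∀ R f j d a c k → k ≡ suc j + R → d (suc j) ≡ a → (a ≡ᵇ 1) ≡ false →
  (∀ i → i < R → d (suc j + suc i) ≡ 1) → R < f →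
  loop1 f d k (d k) c ≡ just (suc j , a , R + c)
loop1-ones zero (suc f) j d a c k k≡ d≡a a≢1 _ _
  rewrite trans (cong d (trans k≡ (+-identityʳ (suc j)))) d≡a | a≢1
  = cong (λ k → just (k , a , c)) (trans k≡ (+-identityʳ (suc j)))
loop1-ones (suc R) (suc f) j d a c k k≡ d≡a a≢1 ones (s≤s R<f)
  rewrite trans (cong d k≡) (ones R ≤-refl)
  = trans (loop1-ones R f j d a (suc c) (k ∸ 1) (trans (cong (_∸ 1) k≡) (+-suc j R)) d≡a a≢1
             (λ i i<R → ones i (m<n⇒m<1+n i<R)) R<f)
          (cong (λ c' → just (suc j , a , c')) (+-suc R c))

-- Runs of the outer loop of RuleDesc(N)

module Execution (N : ℕ) where

  -- Run d k c r: from array d, index k and read counter c, the outer loop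
  -- returns r for every sufficiently large fuel.
  Run : Array → ℕ → ℕ → ℕ → Set
  Run d k c r = Σ ℕ λ f → ∀ f' → f ≤ f' → outer f' N d k c ≡ just r

  -- Leads d k c d' k' c': the state (d', k', c') is reached from (d, k, c),
  -- so every run from the former is a run from the latter.
  Leads : Array → ℕ → ℕ → Array → ℕ → ℕ → Set
  Leads d k c d' k' c' = ∀ r → Run d' k' c' r → Run d k c r

  leads-refl : ∀ {d k c k' c'} → k ≡ k' → c ≡ c' → Leads d k c d k' c'
  leads-refl refl refl r run = run

  leads-cast : ∀ {d k c d' k' c' c''} → Leads d k c d' k' c' → c' ≡ c'' → Leads d k c d' k' c''
  leads-cast leads refl = leads

  leads-step : ∀ {d k c k' m c' d' k'' n''} f₀ → (k ≡ᵇ N) ≡ false →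
    (∀ f → f₀ ≤ f → loop1 f d k (d k) (suc c) ≡ just (k' , m , c')) →
    (∀ f → f₀ ≤ f → loop2 f d k' (m ∸ 1) (m + k ∸ k') ≡ just (d' , k'' , n'')) →
    Leads d k c (d' [ k'' ≔ n'' ]) k'' c'
  leads-step f₀ k≢N loop1≡ loop2≡ r (f₁ , run) = suc (f₀ + f₁) , λ { (suc f) (s≤s f≥) →
    trans (outer-step {f} {N} k≢N (loop1≡ f (≤-trans (m≤m+n f₀ f₁) f≥)) (loop2≡ f (≤-trans (m≤m+n f₀ f₁) f≥)))
          (run f (≤-trans (m≤n+m f₁ f₀) f≥)) }

  _⨾_ : ∀ {d k c d' k' c' d'' k'' c''} →
    Leads d k c d' k' c' → Leads d' k' c' d'' k'' c'' → Leads d k c d'' k'' c''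
  (first ⨾ second) r run = first r (second r run)

  -- One iteration of the outer loop when d_{j+1} = a ≥ 2 is followed by
  -- R ones: it reads R + 1 entries and overwrites d_{j+1}, … with the
  -- greedy composition of a + R into parts a − 1.
  record Decrement (j a' R : ℕ) (d : Array) (c : ℕ) : Set where
    field
      written  : List ℕ
      d'       : Array
      k'       : ℕ
      isGreedy : Greedy (suc a') (suc a' + suc R) written
      stores   : Stores d' j written
      k'≡      : k' ≡ j + length written
      prefix   : ∀ i → i ≤ j → d' i ≡ d i
      leads    : Leads d (suc j + R) c d' k' (R + suc c)

  -- The value n' = m + ℓ − k computed by the algorithm in this situation.
  remainder : ∀ a j R → a + (suc j + R) ∸ suc j ≡ a + R
  remainder a j R = begin
    a + (suc j + R) ∸ suc j  ≡⟨ cong (_∸ suc j) (+-assoc a (suc j) R) ⟨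
    a + suc j + R ∸ suc j    ≡⟨ cong (λ x → x + R ∸ suc j) (+-comm a (suc j)) ⟩
    suc j + a + R ∸ suc j    ≡⟨ cong (_∸ suc j) (+-assoc (suc j) a R) ⟩
    suc j + (a + R) ∸ suc j  ≡⟨ m+n∸m≡n (suc j) (a + R) ⟩
    a + R                    ∎
    where open ≡-Reasoning

  decrement : ∀ j a' R d c → d (suc j) ≡ suc (suc a') → Stores d (suc j) (replicate R 1) →
    suc j + R < N → Decrement j a' R d c
  decrement j a' R d c d≡a ones k<N = record
    { written  = F.written
    ; d'       = F.d₂ [ F.k₂ ≔ F.r₂ ]
    ; k'       = F.k₂
    ; isGreedy = subst (λ x → Greedy (suc a') x F.written)
                   (trans (remainder a j R) (sym (+-suc (suc a') R))) F.isGreedy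
    ; stores   = F.stores
    ; k'≡      = F.k₂≡
    ; prefix   = F.prefix
    ; leads    = leads-step n' (≡ᵇ-< k<N)
        (λ f n'≤f → loop1-ones R f j d a (suc c) (suc j + R) refl d≡a refl
                      (stores-replicate d (suc j) R 1 ones) (R<fuel n'≤f))
        (λ f n'≤f → loop2-fuel n'≤f F.loop2≡)
    }
    where
    a  = suc (suc a')
    n' = a + (suc j + R) ∸ suc j
    F : Fill n' j d (suc a') n'
    F = fill n' j d (suc a') n' (s≤s z≤n) (subst (1 ≤_) (sym (remainder a j R)) (s≤s z≤n)) ≤-refl
    module F = Fill F
    R<fuel : ∀ {f} → n' ≤ f → R < f
    R<fuel n'≤f = ≤-trans (s≤s (m≤n+m R (suc a'))) (≤-trans (≤-reflexive (sym (remainder a j R))) n'≤f)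

  decrement-block : ∀ {j a' R d c} (D : Decrement j a' R d c) → let module D = Decrement D in
    Σ (List ℕ) λ l → Greedy (suc a') (suc R) l × Stores D.d' j (suc a' ∷ l) × D.k' ≡ j + suc (length l)
  decrement-block D with greedy-uncons (Decrement.isGreedy D)
  ... | l , refl , g = l , g , Decrement.stores D , Decrement.k'≡ D

  record ReachesOnes (j T s : ℕ) (d : Array) (k c : ℕ) : Set where
    field
      d'     : Array
      reads  : ℕ
      stores : Stores d' j (replicate T 1)
      prefix : ∀ i → i ≤ j → d' i ≡ d i
      cost   : reads + T + 1 ≡ s
      leads  : Leads d k c d' (j + T) (c + reads)

  reachesOnes-cast : ∀ {j T s s' d k c} → s ≡ s' → ReachesOnes j T s d k c → ReachesOnes j T s' d k c
  reachesOnes-cast refl reaches = reaches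

  reachesOnes-empty : ∀ j a d k c → k ≡ j + 0 → ReachesOnes j 0 (cumBPart a 0) d k c
  reachesOnes-empty j a d k c k≡ = record
    { d' = d ; reads = 0 ; stores = tt ; prefix = λ _ _ → refl
    ; cost = sym (nBPart-zero a) ; leads = leads-refl k≡ (sym (+-identityʳ c)) }

  -- The main invariant, for blocks of total T ≤ B: if d_{j+1} = a is followed
  -- by the greedy composition of R into parts a and k points at its end,
  -- the run turns the block into a + R ones using cumBPart a (a + R) − (a + R) − 1 reads.
  ClaimAt : ℕ → ℕ → Set
  ClaimAt B a = ∀ R T {l} j d k c → a + R ≡ T → T ≤ B → Greedy₀ a R l → Stores d j (a ∷ l) →
    k ≡ j + suc (length l) → j + T ≤ N → ReachesOnes j T (cumBPart a T) d k c

  Claim : ℕ → Set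
  Claim B = ∀ a → 1 ≤ a → ClaimAt B a

  fromGreedy : ∀ B → Claim B → ∀ {a T l} j d k c → 1 ≤ a → Greedy a T l → T ≤ B → Stores d j l →
    k ≡ j + length l → j + T ≤ N → ReachesOnes j T (cumBPart a T) d k c
  fromGreedy B claim {T = T} j d k c _ (last 1≤T T≤a) T≤B st k≡ fits =
    reachesOnes-cast (sym (cum-stable T≤a)) (claim T 1≤T 0 T j d k c (+-identityʳ T) T≤B [] st k≡ fits)
  fromGreedy B claim {a} {T} j d k c 1≤a (a<T ∷ g) T≤B st k≡ fits =
    claim a 1≤a (T ∸ a) T j d k c (m+[n∸m]≡n (<⇒≤ a<T)) T≤B (greedy g) st k≡ fits

  -- A block whose head is 1 consists of ones already.
  ones-case : ∀ B → ClaimAt B 1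
  ones-case B R .(suc R) {l} j d k c refl _ g (d≡1 , ones) k≡ _ with greedy₀-ones g
  ... | refl = record
    { d' = d ; reads = 0 ; stores = d≡1 , ones ; prefix = λ _ _ → refl
    ; cost = trans (+-comm (suc R) 1) (sym (cum-one (suc R)))
    ; leads = leads-refl (trans k≡ (cong (λ x → j + suc x) (length-replicate R))) (sym (+-identityʳ c)) }

  cost-sum : ∀ readsA R readsC T → readsA + suc R + readsC + T + 1 ≡ (readsC + T + 1) + (readsA + R + 1)
  cost-sum = solve-∀

  counter-sum : ∀ c readsA R readsC → R + suc (c + readsA) + readsC ≡ c + (readsA + suc R + readsC)
  counter-sum = solve-∀

  -- Head a ≥ 2: first turn the tail into R ones (induction on T), then one
  -- iteration rewrites the block as a − 1 followed by the greedy composition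
  -- of R + 1 into parts a − 1 (induction on a); cum-split adds up the costs.
  decrement-case : ∀ B a' → Claim B → ClaimAt (suc B) (suc a') → ClaimAt (suc B) (suc (suc a'))
  decrement-case B a' claim claim-a' R .(suc (suc a') + R) {l} j d k c refl T≤ g (d≡a , tail) k≡ fits =
    record
    { d'     = C.d'
    ; reads  = A.reads + suc R + C.reads
    ; stores = C.stores
    ; prefix = λ i i≤j → trans (C.prefix i i≤j) (trans (D.prefix i i≤j) (A.prefix i (m≤n⇒m≤1+n i≤j)))
    ; cost   = begin
        A.reads + suc R + C.reads + T + 1                ≡⟨ cost-sum A.reads R C.reads T ⟩
        (C.reads + T + 1) + (A.reads + R + 1)            ≡⟨ cong₂ _+_ C.cost A.cost ⟩
        cumBPart (suc a') T + cumBPart a R               ≡⟨ cum-split (suc a') R ⟨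
        cumBPart a T                                     ∎
    ; leads  = A.leads ⨾ (D.leads ⨾ leads-cast C.leads (counter-sum c A.reads R C.reads))
    }
    where
    open ≡-Reasoning
    a = suc (suc a')
    T = a + R
    room : ∀ {x} → x ≤ T → j + x ≤ N
    room x≤T = ≤-trans (+-monoʳ-≤ j x≤T) fits
    tailPhase : ∀ {l'} → Greedy₀ a R l' → Stores d (suc j) l' → k ≡ suc j + length l' →
      ReachesOnes (suc j) R (cumBPart a R) d k c
    tailPhase []          _  k≡′ = reachesOnes-empty (suc j) a d k c k≡′
    tailPhase (greedy g′) st k≡′ = fromGreedy B claim (suc j) d k c (s≤s z≤n) g′
      (≤-trans (m≤n+m R (suc a')) (≤-pred T≤)) st k≡′
      (subst (_≤ N) (+-suc j R) (room (s≤s (m≤n+m R (suc a')))))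
    A = tailPhase g tail (trans k≡ (+-suc j (length l)))
    module A = ReachesOnes A
    D = decrement j a' R A.d' (c + A.reads) (trans (A.prefix (suc j) ≤-refl) d≡a) A.stores
      (subst (_≤ N) (trans (+-suc j (suc R)) (cong suc (+-suc j R))) (room (s≤s (s≤s (m≤n+m R a')))))
    module D = Decrement D
    C = let (_ , g″ , st , k≡″) = decrement-block D in
      claim-a' (suc R) T j D.d' D.k' (R + suc (c + A.reads)) (+-suc (suc a') R) T≤ (greedy g″) st k≡″ fits
    module C = ReachesOnes C

  claimAt-all : ∀ B → Claim B → ∀ a' → ClaimAt (suc B) (suc a')
  claimAt-all B claim zero     = ones-case (suc B)
  claimAt-all B claim (suc a') = decrement-case B a' claim (claimAt-all B claim a')

  claim : ∀ B → Claim B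
  claim zero    (suc a') _ R .(suc a' + R) j d k c refl ()
  claim (suc B) (suc a') _ = claimAt-all B (claim B) a'

  -- The initial state holds the one-part block ⟨N⟩; once it has become N
  -- ones, k = N and the outer loop stops.
  run-complete : 1 ≤ N → Σ ℕ λ c → Run ((λ _ → 0) [ 1 ≔ N ]) 1 0 c × c + N + 1 ≡ cumBPart N N
  run-complete 1≤N = R.reads , R.leads R.reads (1 , λ { (suc f) _ → outer-end f N R.d' R.reads }) , R.cost
    where
    R = fromGreedy N (claim N) 0 ((λ _ → 0) [ 1 ≔ N ]) 1 0 1≤N (last 1≤N ≤-refl) ≤-refl
          (update-same (λ _ → 0) 1 N , tt) refl ≤-refl
    module R = ReachesOnes R

sumFrom1-cong : ∀ {p q : ℕ → ℕ} → (∀ x → p x ≡ q x) → ∀ n → sumFrom1 p n ≡ sumFrom1 q n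
sumFrom1-cong p≡q zero    = refl
sumFrom1-cong p≡q (suc n) = cong₂ _+_ (sumFrom1-cong p≡q n) (p≡q (suc n))

theorem3p11 : (n : ℕ) → 1 ≤ n → (p : ℕ → ℕ) → (∀ x → Fin (p x) ↔ Partition x)
    → ∃[ fuel ] ruleDescReads fuel n ≡ just (sumFrom1 p n ∸ n)
theorem3p11 n 1≤n p p↔Partition with Execution.run-complete n 1≤n
... | c , (fuel , run) , cost = fuel , trans (run fuel ≤-refl) (cong just c≡)
  where
  open ≡-Reasoning
  c+n≡ : suc (c + n) ≡ suc (sumFrom1 p n)
  c+n≡ = begin
    suc (c + n)                                ≡⟨ +-comm 1 (c + n) ⟩
    c + n + 1                                  ≡⟨ cost ⟩
    cumBPart n n                               ≡⟨ cum-diagonal n ⟩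
    suc (sumFrom1 (λ x → nBPart x x) n)        ≡⟨ cong suc (sumFrom1-cong (partitionCount p p↔Partition) n) ⟨
    suc (sumFrom1 p n)                         ∎
  c≡ : c ≡ sumFrom1 p n ∸ n
  c≡ = trans (sym (m+n∸n≡m c n)) (cong (_∸ n) (suc-injective c+n≡))
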